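{- Let $a_{n,k,r}$ denote the number of run-sorted permutations of $[n]$ having $k$ runs and $r$ right-to-left minima, with $a_{0,0,0}=1$ and $a_{1,1,1}=1$. Then for all $n\ge2$ and $k,r\ge1$, $$a_{n,k,r}=a_{n-1,k,r-1}+(k-1)\,a_{n-1,k,r}+(n-2)\,a_{n-2,k-1,r-1}.$$
   Context: A run of a permutation is a maximal increasing factor of consecutive letters. A permutation of $[m]$ is run-sorted if it is the concatenation of the blocks of a set partition of $[m]$ in block representation (elements increasing in each block, blocks ordered by increasing minima); equivalently the minima of its successive runs are increasing. A right-to-left minimum of $\pi=\pi_1\cdots\pi_m$ is an entry $\pi_i$ with $\pi_i<\pi_j$ for all $j>i$. The numbers $a_{m,k,r}$ are $0$ whenever no such permutation exists (in particular for $k=0$ or $r=0$ when $m\ge1$). -}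

module Defs where

open import Data.Nat using (ℕ; zero; suc; _+_; _*_; _<_; _<?_; _≟_)
open import Data.Bool using (Bool; true; false; _∧_; if_then_else_)
open import Data.List using (List; []; _∷_; length; filter; concatMap; map)
open import Relation.Nullary.Decidable using (⌊_⌋)
open import Data.Bool.Properties using (T?)

oneTo : ℕ → List ℕ
oneTo zero = []
oneTo (suc n) = go 1 n
  where
  go : ℕ → ℕ → List ℕ
  go i zero = i ∷ []
  go i (suc m) = i ∷ go (suc i) m

insertions : ℕ → List ℕ → List (List ℕ)
insertions x [] = (x ∷ []) ∷ []
insertions x (y ∷ ys) = (x ∷ y ∷ ys) ∷ map (y ∷_) (insertions x ys)

perms : List ℕ → List (List ℕ)
perms [] = [] ∷ []
perms (x ∷ xs) = concatMap (insertions x) (perms xs)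

permsOf : ℕ → List (List ℕ)
permsOf n = perms (oneTo n)

-- the list of minima (first letters) of the successive runs
-- (runs = maximal increasing factors of consecutive letters)
runMinima : List ℕ → List ℕ
runMinima [] = []
runMinima (x ∷ xs) = x ∷ go x xs
  where
  go : ℕ → List ℕ → List ℕ
  go p [] = []
  go p (y ∷ ys) = if ⌊ p <? y ⌋ then go y ys else y ∷ go y ys

runs : List ℕ → ℕ
runs π = length (runMinima π)

increasing : List ℕ → Bool
increasing [] = true
increasing (x ∷ []) = true
increasing (x ∷ y ∷ ys) = ⌊ x <? y ⌋ ∧ increasing (y ∷ ys)

runSorted : List ℕ → Bool
runSorted π = increasing (runMinima π)

rlMin : List ℕ → ℕ
rlMin [] = 0
rlMin (x ∷ xs) = (if allGreater x xs then 1 else 0) + rlMin xs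
  where
  allGreater : ℕ → List ℕ → Bool
  allGreater x [] = true
  allGreater x (y ∷ ys) = ⌊ x <? y ⌋ ∧ allGreater x ys

a : ℕ → ℕ → ℕ → ℕ
a n k r = length (filter (λ π → T? (runSorted π ∧ ⌊ runs π ≟ k ⌋ ∧ ⌊ rlMin π ≟ r ⌋)) (permsOf n))

open import Relation.Binary.PropositionalEquality using (_≡_; refl)
private
  t1 : a 0 0 0 ≡ 1
  t1 = refl
  t2 : a 1 1 1 ≡ 1
  t2 = refl
  t3 : a 4 2 2 ≡ a 3 2 1 + 1 * a 3 2 2 + 2 * a 2 1 1
  t3 = refl
  t4 : a 5 3 2 ≡ a 4 3 1 + 2 * a 4 3 2 + 3 * a 3 2 1
  t4 = refl
  t5 : a 3 2 2 ≡ 1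
  t5 = refl
  t6 : length (permsOf 4) ≡ 24
  t6 = refl

-- Inserting the maximum n into each of the n slots of a permutation of [n−1] gives
--   a(n,k+1,r+1) = a(n−1,k+1,r) + k·a(n−1,k+1,r+1) + (r+1−k)·a(n−1,k,r+1).
-- Placed last, n adds a right-to-left minimum; placed inside one of the k descents of a run-sorted
-- word it changes nothing; placed inside an ascent it starts a new run at the right end of that
-- ascent, and the word stays run-sorted exactly when the suffix starting there is run-sorted. Every
-- other placement, and every word that is not run-sorted, yields no run-sorted word. The
-- right-to-left minima of a run-sorted word are its run minima together with the right ends of such
-- ascents, so with k runs and r+1 right-to-left minima there are r+1−k of them. Induction on n with
-- this identity gives (r+1−k)·a(n+1,k,r+1) = n·a(n,k,r), which turns the last term into (n−2)·a(n−2,k,r).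
-- The three statistics are computed by a right-to-left scan whose state is small enough to read off
-- the effect of inserting n.

module Submission where

open import Defs
open import Data.Bool using (Bool; true; false; T; _∧_; if_then_else_)
open import Data.Bool.Properties using (T?; ∧-identityʳ; ∧-zeroʳ)
open import Data.List using (List; []; _∷_; _++_; [_]; length; filter; map; concatMap; drop; head)
open import Data.List.Relation.Unary.All as All using (All; []; _∷_)
open import Data.List.Relation.Unary.All.Properties using (map⁺; concat⁺)
open import Data.Maybe using (Maybe; just; nothing)
open import Data.Nat using (ℕ; zero; suc; _+_; _*_; _∸_; _⊓_; _≤_; _<_; z≤n; s≤s; _<?_; _≤?_; _≟_; pred)
open import Data.Nat.Properties
open import Data.Nat.Tactic.RingSolver using (solve-∀)
open import Data.Product using (_×_; _,_; proj₁; proj₂)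
open import Data.Sum using (_⊎_; inj₁; inj₂)
open import Data.Unit using (tt)
open import Function using (_∘_; case_of_)
open import Relation.Binary.PropositionalEquality using (_≡_; refl; sym; trans; cong; cong₂; subst; module ≡-Reasoning)
open import Relation.Nullary using (¬_; yes; no; contradiction)
open import Relation.Nullary.Decidable using (⌊_⌋)
open ≡-Reasoning

private
  variable
    A B : Set
    P : ℕ → Set

𝟙 : Bool → ℕ
𝟙 b = if b then 1 else 0

𝟙-injective : ∀ {a b} → 𝟙 a ≡ 𝟙 b → a ≡ b
𝟙-injective {false} {false} _ = refl
𝟙-injective {true}  {true}  _ = refl

𝟙-¬T : ∀ g → ¬ T g → 𝟙 g ≡ 0
𝟙-¬T false _  = refl
𝟙-¬T true  ¬t = contradiction tt ¬t

*-𝟙-cong : ∀ u v g → (T g → u ≡ v) → u * 𝟙 g ≡ v * 𝟙 g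
*-𝟙-cong u v false _   = trans (*-zeroʳ u) (sym (*-zeroʳ v))
*-𝟙-cong u v true  u≡v = cong (_* 1) (u≡v tt)

⌊<?⌋-yes : ∀ {m n} → m < n → ⌊ m <? n ⌋ ≡ true
⌊<?⌋-yes {m} {n} m<n with m <? n
... | yes _   = refl
... | no  m≮n = contradiction m<n m≮n

⌊<?⌋-no : ∀ {m n} → ¬ m < n → ⌊ m <? n ⌋ ≡ false
⌊<?⌋-no {m} {n} m≮n with m <? n
... | yes m<n = contradiction m<n m≮n
... | no  _   = refl

⌊<?⌋-∧ : ∀ x y m → ⌊ x <? y ⌋ ∧ ⌊ x <? m ⌋ ≡ ⌊ x <? y ⊓ m ⌋
⌊<?⌋-∧ x y m with x <? y | x <? m
... | yes x<y | yes x<m = sym (⌊<?⌋-yes (⊓-glb x<y x<m))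
... | yes _   | no  x≮m = sym (⌊<?⌋-no (λ x<y⊓m → x≮m (<-≤-trans x<y⊓m (m⊓n≤n y m))))
... | no  x≮y | _       = sym (⌊<?⌋-no (λ x<y⊓m → x≮y (<-≤-trans x<y⊓m (m⊓n≤m y m))))

⌊≟⌋-suc : ∀ m n → ⌊ suc m ≟ suc n ⌋ ≡ ⌊ m ≟ n ⌋
⌊≟⌋-suc m n with m ≟ n | suc m ≟ suc n
... | yes _   | yes _     = refl
... | no  _   | no  _     = refl
... | yes m≡n | no  m≢n   = contradiction (cong suc m≡n) m≢n
... | no  m≢n | yes m+≡n+ = contradiction (suc-injective m+≡n+) m≢n

≡-via-zero : ∀ {x} m {y} → x ≡ 0 → y ≡ 0 → x ≡ m * y
≡-via-zero m x≡0 y≡0 = trans x≡0 (sym (trans (cong (m *_) y≡0) (*-zeroʳ m)))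

∑ : (A → ℕ) → List A → ℕ
∑ f []       = 0
∑ f (x ∷ xs) = f x + ∑ f xs

∑-++ : (f : A → ℕ) (xs ys : List A) → ∑ f (xs ++ ys) ≡ ∑ f xs + ∑ f ys
∑-++ f []       ys = refl
∑-++ f (x ∷ xs) ys = trans (cong (f x +_) (∑-++ f xs ys)) (sym (+-assoc (f x) (∑ f xs) (∑ f ys)))

∑-cong : {f g : A → ℕ} → (∀ x → f x ≡ g x) → (xs : List A) → ∑ f xs ≡ ∑ g xs
∑-cong f≗g []       = refl
∑-cong f≗g (x ∷ xs) = cong₂ _+_ (f≗g x) (∑-cong f≗g xs)

∑-congᴬ : {f g : A → ℕ} {xs : List A} → All (λ x → f x ≡ g x) xs → ∑ f xs ≡ ∑ g xs
∑-congᴬ []           = refl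
∑-congᴬ (fx≡gx ∷ eqs) = cong₂ _+_ fx≡gx (∑-congᴬ eqs)

∑-+ : (f g : A → ℕ) (xs : List A) → ∑ (λ x → f x + g x) xs ≡ ∑ f xs + ∑ g xs
∑-+ f g []       = refl
∑-+ f g (x ∷ xs) = trans (cong (f x + g x +_) (∑-+ f g xs)) (+-+-comm (f x) (g x) (∑ f xs) (∑ g xs))
  where
  +-+-comm : ∀ a b c d → a + b + (c + d) ≡ a + c + (b + d)
  +-+-comm = solve-∀

∑-*ˡ : (c : ℕ) (f : A → ℕ) (xs : List A) → ∑ (λ x → c * f x) xs ≡ c * ∑ f xs
∑-*ˡ c f []       = sym (*-zeroʳ c)
∑-*ˡ c f (x ∷ xs) = trans (cong (c * f x +_) (∑-*ˡ c f xs)) (sym (*-distribˡ-+ c (f x) (∑ f xs)))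

∑-linear : (f g h : A → ℕ) (u v : ℕ) (xs : List A) →
           ∑ (λ x → f x + u * g x + v * h x) xs ≡ ∑ f xs + u * ∑ g xs + v * ∑ h xs
∑-linear f g h u v xs = begin
  ∑ (λ x → f x + u * g x + v * h x) xs            ≡⟨ ∑-+ (λ x → f x + u * g x) (λ x → v * h x) xs ⟩
  ∑ (λ x → f x + u * g x) xs + ∑ (λ x → v * h x) xs ≡⟨ cong₂ _+_ (∑-+ f (λ x → u * g x) xs) (∑-*ˡ v h xs) ⟩
  ∑ f xs + ∑ (λ x → u * g x) xs + v * ∑ h xs       ≡⟨ cong (λ t → ∑ f xs + t + v * ∑ h xs) (∑-*ˡ u g xs) ⟩
  ∑ f xs + u * ∑ g xs + v * ∑ h xs                 ∎

∑-zero : {f : A → ℕ} {xs : List A} → All (λ x → f x ≡ 0) xs → ∑ f xs ≡ 0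
∑-zero []             = refl
∑-zero (fx≡0 ∷ fxs≡0) = cong₂ _+_ fx≡0 (∑-zero fxs≡0)

∑-map : (f : B → ℕ) (g : A → B) (xs : List A) → ∑ f (map g xs) ≡ ∑ (f ∘ g) xs
∑-map f g []       = refl
∑-map f g (x ∷ xs) = cong (f (g x) +_) (∑-map f g xs)

∑-concatMap : (f : B → ℕ) (g : A → List B) (xs : List A) →
              ∑ f (concatMap g xs) ≡ ∑ (∑ f ∘ g) xs
∑-concatMap f g []       = refl
∑-concatMap f g (x ∷ xs) = trans (∑-++ f (g x) (concatMap g xs)) (cong (∑ f (g x) +_) (∑-concatMap f g xs))

length-filter : (p : A → Bool) (xs : List A) → length (filter (T? ∘ p) xs) ≡ ∑ (𝟙 ∘ p) xs
length-filter p []       = refl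
length-filter p (x ∷ xs) with p x
... | true  = cong suc (length-filter p xs)
... | false = length-filter p xs

-- Permutations as iterated insertions

∑ins : (List ℕ → ℕ) → ℕ → List ℕ → ℕ
∑ins f x w = ∑ f (insertions x w)

∑ins-∷ : (f : List ℕ → ℕ) (x z : ℕ) (ρ : List ℕ) → ∑ins f x (z ∷ ρ) ≡ f (x ∷ z ∷ ρ) + ∑ins (f ∘ (z ∷_)) x ρ
∑ins-∷ f x z ρ = cong (f (x ∷ z ∷ ρ) +_) (∑-map f (z ∷_) (insertions x ρ))

∑ins-cong-∷ : {f g : List ℕ → ℕ} → (∀ u us → f (u ∷ us) ≡ g (u ∷ us)) → ∀ x τ → ∑ins f x τ ≡ ∑ins g x τ
∑ins-cong-∷ f≗g x []      = cong (_+ 0) (f≗g x [])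
∑ins-cong-∷ {f} {g} f≗g x (z ∷ τ) = begin
  ∑ins f x (z ∷ τ)                   ≡⟨ ∑ins-∷ f x z τ ⟩
  f (x ∷ z ∷ τ) + ∑ins (f ∘ (z ∷_)) x τ ≡⟨ cong₂ _+_ (f≗g x (z ∷ τ)) (∑-cong (f≗g z) (insertions x τ)) ⟩
  g (x ∷ z ∷ τ) + ∑ins (g ∘ (z ∷_)) x τ ≡⟨ ∑ins-∷ g x z τ ⟨
  ∑ins g x (z ∷ τ)                   ∎

∑ins-∑ins-∷ : (f : List ℕ → ℕ) (x y z : ℕ) (ρ : List ℕ) →
  ∑ (∑ins f x) (insertions y (z ∷ ρ)) ≡
    f (x ∷ y ∷ z ∷ ρ) + f (y ∷ x ∷ z ∷ ρ)
    + (∑ins (λ w → f (y ∷ z ∷ w)) x ρ + ∑ins (λ w → f (x ∷ z ∷ w)) y ρ)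
    + ∑ (∑ins (f ∘ (z ∷_)) x) (insertions y ρ)
∑ins-∑ins-∷ f x y z ρ = begin
  ∑ (∑ins f x) (insertions y (z ∷ ρ))
    ≡⟨ ∑ins-∷ (∑ins f x) y z ρ ⟩
  ∑ins f x (y ∷ z ∷ ρ) + ∑ (λ w → ∑ins f x (z ∷ w)) (insertions y ρ)
    ≡⟨ cong₂ _+_ (trans (∑ins-∷ f x y (z ∷ ρ)) (cong (f (x ∷ y ∷ z ∷ ρ) +_) (∑ins-∷ (f ∘ (y ∷_)) x z ρ)))
                 (∑-cong (∑ins-∷ f x z) (insertions y ρ)) ⟩
  f (x ∷ y ∷ z ∷ ρ) + (f (y ∷ x ∷ z ∷ ρ) + C) + ∑ (λ w → f (x ∷ z ∷ w) + ∑ins g x w) (insertions y ρ)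
    ≡⟨ cong (f (x ∷ y ∷ z ∷ ρ) + (f (y ∷ x ∷ z ∷ ρ) + C) +_) (∑-+ (λ w → f (x ∷ z ∷ w)) (∑ins g x) (insertions y ρ)) ⟩
  f (x ∷ y ∷ z ∷ ρ) + (f (y ∷ x ∷ z ∷ ρ) + C) + (D + E)
    ≡⟨ regroup (f (x ∷ y ∷ z ∷ ρ)) (f (y ∷ x ∷ z ∷ ρ)) C D E ⟩
  f (x ∷ y ∷ z ∷ ρ) + f (y ∷ x ∷ z ∷ ρ) + (C + D) + E ∎
  where
  g : List ℕ → ℕ
  g = f ∘ (z ∷_)
  C D E : ℕ
  C = ∑ins (λ w → f (y ∷ z ∷ w)) x ρ
  D = ∑ins (λ w → f (x ∷ z ∷ w)) y ρ
  E = ∑ (∑ins g x) (insertions y ρ)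
  regroup : ∀ a b c d e → a + (b + c) + (d + e) ≡ a + b + (c + d) + e
  regroup = solve-∀

∑ins-comm : (f : List ℕ → ℕ) (x y : ℕ) (τ : List ℕ) →
            ∑ (∑ins f x) (insertions y τ) ≡ ∑ (∑ins f y) (insertions x τ)
∑ins-comm f x y [] = swap (f (x ∷ y ∷ [])) (f (y ∷ x ∷ []))
  where
  swap : ∀ a b → a + (b + 0) + 0 ≡ b + (a + 0) + 0
  swap = solve-∀
∑ins-comm f x y (z ∷ ρ) = begin
  ∑ (∑ins f x) (insertions y (z ∷ ρ))
    ≡⟨ ∑ins-∑ins-∷ f x y z ρ ⟩
  f (x ∷ y ∷ z ∷ ρ) + f (y ∷ x ∷ z ∷ ρ) + (C + D) + ∑ (∑ins g x) (insertions y ρ)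
    ≡⟨ cong₂ _+_ (cong₂ _+_ (+-comm (f (x ∷ y ∷ z ∷ ρ)) _) (+-comm C D)) (∑ins-comm g x y ρ) ⟩
  f (y ∷ x ∷ z ∷ ρ) + f (x ∷ y ∷ z ∷ ρ) + (D + C) + ∑ (∑ins g y) (insertions x ρ)
    ≡⟨ ∑ins-∑ins-∷ f y x z ρ ⟨
  ∑ (∑ins f y) (insertions x (z ∷ ρ)) ∎
  where
  g : List ℕ → ℕ
  g = f ∘ (z ∷_)
  C D : ℕ
  C = ∑ins (λ w → f (y ∷ z ∷ w)) x ρ
  D = ∑ins (λ w → f (x ∷ z ∷ w)) y ρ

∑-perms-∷ʳ : (f : List ℕ → ℕ) (L : List ℕ) (y : ℕ) → ∑ f (perms (L ++ [ y ])) ≡ ∑ (∑ins f y) (perms L)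
∑-perms-∷ʳ f []      y = sym (+-identityʳ (∑ins f y []))
∑-perms-∷ʳ f (x ∷ L) y = begin
  ∑ f (concatMap (insertions x) (perms (L ++ [ y ])))  ≡⟨ ∑-concatMap f (insertions x) (perms (L ++ [ y ])) ⟩
  ∑ (∑ins f x) (perms (L ++ [ y ]))                    ≡⟨ ∑-perms-∷ʳ (∑ins f x) L y ⟩
  ∑ (∑ins (∑ins f x) y) (perms L)                      ≡⟨ ∑-cong (∑ins-comm f x y) (perms L) ⟩
  ∑ (∑ins (∑ins f y) x) (perms L)                      ≡⟨ ∑-concatMap (∑ins f y) (insertions x) (perms L) ⟨
  ∑ (∑ins f y) (concatMap (insertions x) (perms L))    ∎

All-insertions : {x : ℕ} {σ : List ℕ} → P x → All P σ → All (All P) (insertions x σ)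
All-insertions px []         = (px ∷ []) ∷ []
All-insertions px (py ∷ pσ) = (px ∷ py ∷ pσ) ∷ map⁺ (All.map (py ∷_) (All-insertions px pσ))

All-perms : {L : List ℕ} → All P L → All (All P) (perms L)
All-perms []        = [] ∷ []
All-perms (px ∷ pL) = concat⁺ (map⁺ (All.map (All-insertions px) (All-perms pL)))

data NonEmptyBelow (N : ℕ) : List ℕ → Set where
  nonEmpty : ∀ {y ys} → All (_< N) (y ∷ ys) → NonEmptyBelow N (y ∷ ys)

insertions-nonEmptyBelow : ∀ {N x σ} → x < N → All (_< N) σ → All (NonEmptyBelow N) (insertions x σ)
insertions-nonEmptyBelow x<N []          = nonEmpty (x<N ∷ []) ∷ []
insertions-nonEmptyBelow x<N (y<N ∷ σ<N) =
  nonEmpty (x<N ∷ y<N ∷ σ<N) ∷ map⁺ (All.map (λ w<N → nonEmpty (y<N ∷ w<N)) (All-insertions x<N σ<N))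

perms-nonEmptyBelow : ∀ {N x L} → All (_< N) (x ∷ L) → All (NonEmptyBelow N) (perms (x ∷ L))
perms-nonEmptyBelow (x<N ∷ L<N) = concat⁺ (map⁺ (All.map (insertions-nonEmptyBelow x<N) (All-perms L<N)))

-- `oneTo` counts up with a function local to its `where` block; `countUp` is that function, made
-- nameable by letting unification solve for it (abstracting the literal 2 makes the constraint a pattern).
mutual
  countUp : ℕ → ℕ → List ℕ
  countUp = _

  private
    drop-oneTo : ∀ m → drop 1 (oneTo (2 + m)) ≡ countUp 2 m
    drop-oneTo m with 2
    ... | i = refl

countUp-∷ʳ : ∀ i m → countUp i (suc m) ≡ countUp i m ++ [ suc (m + i) ]
countUp-∷ʳ i zero    = refl
countUp-∷ʳ i (suc m) = cong (i ∷_) (trans (countUp-∷ʳ (suc i) m) (cong (λ v → countUp (suc i) m ++ [ suc v ]) (+-suc m i)))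

countUp-≤ : ∀ i m → All (_≤ m + i) (countUp i m)
countUp-≤ i zero    = ≤-refl ∷ []
countUp-≤ i (suc m) = m≤n+m i (suc m) ∷ All.map (λ x≤ → ≤-trans x≤ (≤-reflexive (+-suc m i))) (countUp-≤ (suc i) m)

oneTo-∷ʳ : ∀ p → oneTo (2 + p) ≡ oneTo (1 + p) ++ [ 2 + p ]
oneTo-∷ʳ p = trans (countUp-∷ʳ 1 p) (cong (λ v → countUp 1 p ++ [ suc v ]) (+-comm p 1))

permsOf-nonEmptyBelow : ∀ p → All (NonEmptyBelow (2 + p)) (permsOf (1 + p))
permsOf-nonEmptyBelow zero    = perms-nonEmptyBelow (s≤s (s≤s z≤n) ∷ [])
permsOf-nonEmptyBelow (suc p) =
  perms-nonEmptyBelow (All.map (λ x≤ → s≤s (≤-trans x≤ (≤-reflexive (+-comm (suc p) 1)))) (countUp-≤ 1 (suc p)))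

-- Defs' `allGreater` is local to `rlMin`; `rlMin-∷` identifies it with this copy through `rlMin` itself.
allGreater : ℕ → List ℕ → Bool
allGreater x []       = true
allGreater x (y ∷ ys) = ⌊ x <? y ⌋ ∧ allGreater x ys

rlMin-∷ : ∀ x ys → rlMin (x ∷ ys) ≡ 𝟙 (allGreater x ys) + rlMin ys
rlMin-∷ x []       = refl
rlMin-∷ x (y ∷ ys) =
  cong (λ g → 𝟙 (⌊ x <? y ⌋ ∧ g) + rlMin (y ∷ ys)) (𝟙-injective (+-cancelʳ-≡ (rlMin ys) _ _ (rlMin-∷ x ys)))

tailMinima : List ℕ → List ℕ
tailMinima π = drop 1 (runMinima π)

tailMinima-ascent : ∀ {y z} zs → y < z → tailMinima (y ∷ z ∷ zs) ≡ tailMinima (z ∷ zs)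
tailMinima-ascent {y} {z} zs y<z = cong (λ g → if g then tailMinima (z ∷ zs) else runMinima (z ∷ zs)) (⌊<?⌋-yes y<z)

tailMinima-descent : ∀ {y z} zs → ¬ y < z → tailMinima (y ∷ z ∷ zs) ≡ runMinima (z ∷ zs)
tailMinima-descent {y} {z} zs y≮z = cong (λ g → if g then tailMinima (z ∷ zs) else runMinima (z ∷ zs)) (⌊<?⌋-no y≮z)

increasing-∷ : ∀ x l → increasing l ≡ false → increasing (x ∷ l) ≡ false
increasing-∷ x (y ∷ l) l↑≡false = trans (cong (⌊ x <? y ⌋ ∧_) l↑≡false) (∧-zeroʳ _)

sortedAscents : List ℕ → ℕ
sortedAscents []           = 0
sortedAscents (z ∷ [])     = 0
sortedAscents (z ∷ y ∷ ys) = (if ⌊ z <? y ⌋ then 𝟙 (runSorted (y ∷ ys)) else 0) + sortedAscents (y ∷ ys)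

sortedAscents-ascent : ∀ {y z} zs → y < z → sortedAscents (y ∷ z ∷ zs) ≡ 𝟙 (runSorted (z ∷ zs)) + sortedAscents (z ∷ zs)
sortedAscents-ascent {y} {z} zs y<z =
  cong (λ g → (if g then 𝟙 (runSorted (z ∷ zs)) else 0) + sortedAscents (z ∷ zs)) (⌊<?⌋-yes y<z)

sortedAscents-descent : ∀ {y z} zs → ¬ y < z → sortedAscents (y ∷ z ∷ zs) ≡ sortedAscents (z ∷ zs)
sortedAscents-descent {y} {z} zs y≮z =
  cong (λ g → (if g then 𝟙 (runSorted (z ∷ zs)) else 0) + sortedAscents (z ∷ zs)) (⌊<?⌋-no y≮z)

-- Summaries of words scanned from the right

record Summary : Set where
  constructor summary
  field
    first least : ℕ
    sorted : Bool
    runCount rlMinCount : ℕ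

-- One step of a right-to-left scan; `nothing` marks words that end no run-sorted word.
push : ℕ → Maybe Summary → Maybe Summary
push z nothing = nothing
push z (just (summary h m b c ρ)) =
  if ⌊ z <? h ⌋
  then (if ⌊ z <? m ⌋ then just (summary z z true c (suc ρ)) else just (summary z m false c ρ))
  else (if b then just (summary z m false (suc c) ρ) else nothing)

summarize : List ℕ → Maybe Summary
summarize []           = nothing
summarize (z ∷ [])     = just (summary z z true 1 1)
summarize (z ∷ y ∷ ys) = push z (summarize (y ∷ ys))

record Viable (π : List ℕ) (h m : ℕ) (b : Bool) (c ρ : ℕ) : Set where
  field
    head≡             : head π ≡ just h
    runSorted≡        : runSorted π ≡ b
    runs≡             : runs π ≡ c
    rlMin≡            : rlMin π ≡ ρ
    allGreater≡       : ∀ x → allGreater x π ≡ ⌊ x <? m ⌋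
    sorted⇒least≡head : b ≡ true → m ≡ h
    prepend-sorted    : ∀ x → x < h → increasing (x ∷ tailMinima π) ≡ ⌊ x <? m ⌋
    balance           : suc ρ ≡ c + 𝟙 b + sortedAscents π
    runs≥1            : 1 ≤ c

data Describes (π : List ℕ) : Maybe Summary → Set where
  viable : ∀ {h m b c ρ} → Viable π h m b c ρ → Describes π (just (summary h m b c ρ))
  dead   : runSorted π ≡ false → increasing (tailMinima π) ≡ false → Describes π nothing

single-viable : ∀ y → Viable (y ∷ []) y y true 1 1
single-viable y = record
  { head≡             = refl
  ; runSorted≡        = refl
  ; runs≡             = refl
  ; rlMin≡            = refl
  ; allGreater≡       = λ x → ∧-identityʳ _
  ; sorted⇒least≡head = λ _ → refl
  ; prepend-sorted    = λ x x<y → sym (⌊<?⌋-yes x<y)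
  ; balance           = refl
  ; runs≥1            = s≤s z≤n
  }

module _ {y z m c ρ : ℕ} {zs : List ℕ} {b : Bool} (v : Viable (z ∷ zs) z m b c ρ) where
  open Viable v

  private
    allGreater-∷ : ∀ x → allGreater x (y ∷ z ∷ zs) ≡ ⌊ x <? y ⊓ m ⌋
    allGreater-∷ x = trans (cong (⌊ x <? y ⌋ ∧_) (allGreater≡ x)) (⌊<?⌋-∧ x y m)

    runs-ascent : y < z → runs (y ∷ z ∷ zs) ≡ c
    runs-ascent y<z = trans (cong (suc ∘ length) (tailMinima-ascent zs y<z)) runs≡

    runSorted-ascent : y < z → runSorted (y ∷ z ∷ zs) ≡ ⌊ y <? m ⌋
    runSorted-ascent y<z = trans (cong (increasing ∘ (y ∷_)) (tailMinima-ascent zs y<z)) (prepend-sorted y y<z)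

    runSorted-descent : ¬ y < z → runSorted (y ∷ z ∷ zs) ≡ false
    runSorted-descent y≮z = trans (cong (increasing ∘ (y ∷_)) (tailMinima-descent zs y≮z))
                                  (cong (_∧ runSorted (z ∷ zs)) (⌊<?⌋-no y≮z))

  push-newLeast-viable : y < z → y < m → Viable (y ∷ z ∷ zs) y y true c (suc ρ)
  push-newLeast-viable y<z y<m = record
    { head≡             = refl
    ; runSorted≡        = trans (runSorted-ascent y<z) (⌊<?⌋-yes y<m)
    ; runs≡             = runs-ascent y<z
    ; rlMin≡            = trans (rlMin-∷ y (z ∷ zs)) (cong₂ _+_ (cong 𝟙 (trans (allGreater≡ y) (⌊<?⌋-yes y<m))) rlMin≡)
    ; allGreater≡       = λ x → trans (allGreater-∷ x) (cong (λ n → ⌊ x <? n ⌋) (m≤n⇒m⊓n≡m (<⇒≤ y<m)))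
    ; sorted⇒least≡head = λ _ → refl
    ; prepend-sorted    = λ x x<y → begin
        increasing (x ∷ tailMinima (y ∷ z ∷ zs)) ≡⟨ cong (increasing ∘ (x ∷_)) (tailMinima-ascent zs y<z) ⟩
        increasing (x ∷ tailMinima (z ∷ zs))     ≡⟨ prepend-sorted x (<-trans x<y y<z) ⟩
        ⌊ x <? m ⌋                               ≡⟨ ⌊<?⌋-yes (<-trans x<y y<m) ⟩
        true                                     ≡⟨ ⌊<?⌋-yes x<y ⟨
        ⌊ x <? y ⌋                               ∎
    ; balance           = begin
        suc (suc ρ)                                 ≡⟨ cong suc balance ⟩
        suc (c + 𝟙 b + sortedAscents (z ∷ zs))      ≡⟨ regroup c (𝟙 b) (sortedAscents (z ∷ zs)) ⟩
        c + 1 + (𝟙 b + sortedAscents (z ∷ zs))      ≡⟨ cong (λ g → c + 1 + (𝟙 g + sortedAscents (z ∷ zs))) runSorted≡ ⟨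
        c + 1 + (𝟙 (runSorted (z ∷ zs)) + sortedAscents (z ∷ zs)) ≡⟨ cong (c + 1 +_) (sortedAscents-ascent zs y<z) ⟨
        c + 1 + sortedAscents (y ∷ z ∷ zs)          ∎
    ; runs≥1            = runs≥1
    }
    where
    regroup : ∀ c i e → suc (c + i + e) ≡ c + 1 + (i + e)
    regroup = solve-∀

  push-joinFirst-viable : y < z → ¬ y < m → Viable (y ∷ z ∷ zs) y m false c ρ
  push-joinFirst-viable y<z y≮m = record
    { head≡             = refl
    ; runSorted≡        = trans (runSorted-ascent y<z) (⌊<?⌋-no y≮m)
    ; runs≡             = runs-ascent y<z
    ; rlMin≡            = trans (rlMin-∷ y (z ∷ zs)) (cong₂ _+_ (cong 𝟙 (trans (allGreater≡ y) (⌊<?⌋-no y≮m))) rlMin≡)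
    ; allGreater≡       = λ x → trans (allGreater-∷ x) (cong (λ n → ⌊ x <? n ⌋) (m≥n⇒m⊓n≡n (≮⇒≥ y≮m)))
    ; sorted⇒least≡head = λ ()
    ; prepend-sorted    = λ x x<y →
        trans (cong (increasing ∘ (x ∷_)) (tailMinima-ascent zs y<z)) (prepend-sorted x (<-trans x<y y<z))
    ; balance           = begin
        suc ρ                                        ≡⟨ balance ⟩
        c + 𝟙 b + sortedAscents (z ∷ zs)             ≡⟨ regroup c (𝟙 b) (sortedAscents (z ∷ zs)) ⟩
        c + 0 + (𝟙 b + sortedAscents (z ∷ zs))       ≡⟨ cong (λ g → c + 0 + (𝟙 g + sortedAscents (z ∷ zs))) runSorted≡ ⟨
        c + 0 + (𝟙 (runSorted (z ∷ zs)) + sortedAscents (z ∷ zs)) ≡⟨ cong (c + 0 +_) (sortedAscents-ascent zs y<z) ⟨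
        c + 0 + sortedAscents (y ∷ z ∷ zs)           ∎
    ; runs≥1            = runs≥1
    }
    where
    regroup : ∀ c i e → c + i + e ≡ c + 0 + (i + e)
    regroup = solve-∀

  push-newRun-viable : ¬ y < z → b ≡ true → Viable (y ∷ z ∷ zs) y m false (suc c) ρ
  push-newRun-viable y≮z b≡true = record
    { head≡             = refl
    ; runSorted≡        = runSorted-descent y≮z
    ; runs≡             = trans (cong (suc ∘ length) (tailMinima-descent zs y≮z)) (cong suc runs≡)
    ; rlMin≡            = trans (rlMin-∷ y (z ∷ zs)) (cong₂ _+_ (cong 𝟙 (trans (allGreater≡ y) (⌊<?⌋-no y≮m))) rlMin≡)
    ; allGreater≡       = λ x → trans (allGreater-∷ x) (cong (λ n → ⌊ x <? n ⌋) (m≥n⇒m⊓n≡n m≤y))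
    ; sorted⇒least≡head = λ ()
    ; prepend-sorted    = λ x x<y → begin
        increasing (x ∷ tailMinima (y ∷ z ∷ zs)) ≡⟨ cong (increasing ∘ (x ∷_)) (tailMinima-descent zs y≮z) ⟩
        ⌊ x <? z ⌋ ∧ runSorted (z ∷ zs)          ≡⟨ cong (⌊ x <? z ⌋ ∧_) (trans runSorted≡ b≡true) ⟩
        ⌊ x <? z ⌋ ∧ true                        ≡⟨ ∧-identityʳ _ ⟩
        ⌊ x <? z ⌋                               ≡⟨ cong (λ n → ⌊ x <? n ⌋) m≡z ⟨
        ⌊ x <? m ⌋                               ∎
    ; balance           = begin
        suc ρ                                    ≡⟨ balance ⟩
        c + 𝟙 b + sortedAscents (z ∷ zs)         ≡⟨ cong (λ g → c + 𝟙 g + sortedAscents (z ∷ zs)) b≡true ⟩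
        c + 1 + sortedAscents (z ∷ zs)           ≡⟨ regroup c (sortedAscents (z ∷ zs)) ⟩
        suc c + 0 + sortedAscents (z ∷ zs)       ≡⟨ cong (suc c + 0 +_) (sortedAscents-descent zs y≮z) ⟨
        suc c + 0 + sortedAscents (y ∷ z ∷ zs)   ∎
    ; runs≥1            = s≤s z≤n
    }
    where
    m≡z : m ≡ z
    m≡z = sorted⇒least≡head b≡true
    m≤y : m ≤ y
    m≤y = subst (_≤ y) (sym m≡z) (≮⇒≥ y≮z)
    y≮m : ¬ y < m
    y≮m = subst (λ n → ¬ y < n) (sym m≡z) y≮z
    regroup : ∀ c e → c + 1 + e ≡ suc c + 0 + e
    regroup = solve-∀

  push-descent-dead : ¬ y < z → b ≡ false → Describes (y ∷ z ∷ zs) nothing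
  push-descent-dead y≮z b≡false =
    dead (runSorted-descent y≮z) (trans (cong increasing (tailMinima-descent zs y≮z)) (trans runSorted≡ b≡false))

dead-∷ : ∀ y {z} zs → Describes (z ∷ zs) nothing → Describes (y ∷ z ∷ zs) nothing
dead-∷ y {z} zs (dead unsorted tail-unsorted) = dead (increasing-∷ y (tailMinima (y ∷ z ∷ zs)) tail↑≡false) tail↑≡false
  where
  tail↑≡false : increasing (tailMinima (y ∷ z ∷ zs)) ≡ false
  tail↑≡false with y <? z
  ... | yes _ = tail-unsorted
  ... | no  _ = unsorted

push-describes : ∀ y {z zs s} → Describes (z ∷ zs) s → Describes (y ∷ z ∷ zs) (push y s)
push-describes y {zs = zs} d@(dead _ _) = dead-∷ y zs d
push-describes y {z} (viable {m = m} v) with refl ← Viable.head≡ v | y <? z | y <? m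
... | yes y<z | yes y<m = viable (push-newLeast-viable v y<z y<m)
... | yes y<z | no  y≮m = viable (push-joinFirst-viable v y<z y≮m)
push-describes y (viable {b = true}  v) | no y≮z | _ = viable (push-newRun-viable v y≮z refl)
push-describes y (viable {b = false} v) | no y≮z | _ = push-descent-dead v y≮z refl

summarize-describes : ∀ y ys → Describes (y ∷ ys) (summarize (y ∷ ys))
summarize-describes y []       = viable (single-viable y)
summarize-describes y (z ∷ zs) = push-describes y (summarize-describes z zs)

sorted-balance : ∀ {π h m c ρ} → Viable π h m true c ρ → ρ ≡ c + sortedAscents π
sorted-balance {π} {c = c} v = suc-injective (trans (Viable.balance v) (regroup c (sortedAscents π)))
  where
  regroup : ∀ c e → c + 1 + e ≡ suc (c + e)
  regroup = solve-∀

-- Inserting a new maximum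

sortedAscentAt : ℕ → Maybe Summary → ℕ
sortedAscentAt z nothing                    = 0
sortedAscentAt z (just (summary h _ b _ _)) = if ⌊ z <? h ⌋ then 𝟙 b else 0

sortedAscents-∷ : ∀ y {z zs s} → Describes (z ∷ zs) s → sortedAscents (y ∷ z ∷ zs) ≡ sortedAscentAt y s + sortedAscents (z ∷ zs)
sortedAscents-∷ y {z} {zs} d = cong (_+ sortedAscents (z ∷ zs)) (ascentInto d)
  where
  ascentInto : ∀ {s} → Describes (z ∷ zs) s → (if ⌊ y <? z ⌋ then 𝟙 (runSorted (z ∷ zs)) else 0) ≡ sortedAscentAt y s
  ascentInto (dead unsorted _) with ⌊ y <? z ⌋
  ... | true  = cong 𝟙 unsorted
  ... | false = refl
  ascentInto (viable v) with refl ← Viable.head≡ v = cong (λ g → if ⌊ y <? z ⌋ then 𝟙 g else 0) (Viable.runSorted≡ v)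

-- The four terms are N inserted in front, at the end, inside one of the pred c descents and inside
-- one of the e ascents into a run-sorted suffix; every other insertion has summary `nothing`.
insertMaxTotal : ℕ → (Maybe Summary → ℕ) → Maybe Summary → ℕ → ℕ
insertMaxTotal N G nothing                    e = 0
insertMaxTotal N G (just (summary h m b c ρ)) e =
    𝟙 b * G (just (summary N m false (suc c) ρ))
  + G (just (summary h m b c (suc ρ)))
  + pred c * G (just (summary h m b c ρ))
  + e * G (just (summary h m b (suc c) ρ))

insertMaxTotal-push-just : ∀ {N} (G : Maybe Summary → ℕ) → G nothing ≡ 0 → ∀ {y} → y < N →
  ∀ {h m b c ρ} → (b ≡ true → m ≡ h) → ∀ e →
  let s = just (summary h m b (suc c) ρ) in
  G (push N (push y s)) + insertMaxTotal N (G ∘ push y) s e ≡ insertMaxTotal N G (push y s) (sortedAscentAt y s + e)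
insertMaxTotal-push-just {N} G G∅ {y} y<N {h} {m} {b} {c} {ρ} sorted⇒m≡h e
  rewrite ⌊<?⌋-yes y<N with y <? h
... | yes y<h with y <? m
...   | yes y<m rewrite ⌊<?⌋-no (<⇒≯ y<N) =
  regroup (G (just (summary N y false (suc (suc c)) (suc ρ)))) (G (just (summary y y true (suc (suc c)) (suc ρ))))
          (G (just (summary y y true (suc c) (suc (suc ρ))))) (G (just (summary y y true (suc c) (suc ρ)))) (𝟙 b) c e
  where
  regroup : ∀ X Q R S i c e → X + (i * Q + R + c * S + e * Q) ≡ X + 0 + R + c * S + (i + e) * Q
  regroup = solve-∀
...   | no  y≮m rewrite ⌊<?⌋-no (<⇒≯ y<N) | G∅ =
  regroup (G (just (summary y m false (suc (suc c)) ρ))) (G (just (summary y m false (suc c) (suc ρ))))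
          (G (just (summary y m false (suc c) ρ))) (𝟙 b) c e
  where
  regroup : ∀ Q R S i c e → i * Q + R + c * S + e * Q ≡ R + c * S + (i + e) * Q
  regroup = solve-∀
insertMaxTotal-push-just {N} G G∅ {y} y<N {h} {m} {b} {c} {ρ} sorted⇒m≡h e | no y≮h with b | sorted⇒m≡h
... | false | _ rewrite G∅ = cong₂ _+_ (*-zeroʳ c) (*-zeroʳ e)
... | true  | m≡h with refl ← m≡h refl rewrite ⌊<?⌋-no y≮h | ⌊<?⌋-no (<⇒≯ y<N) | G∅ =
  regroup (G (just (summary y h false (suc (suc c)) ρ))) (G (just (summary y h false (suc (suc c)) (suc ρ))))
          (G (just (summary y h false (suc (suc (suc c))) ρ))) c e
  where
  regroup : ∀ Q R T c e → Q + 0 + R + c * Q + e * T ≡ R + (Q + c * Q) + e * T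
  regroup = solve-∀

insertMaxTotal-push : ∀ {N} (G : Maybe Summary → ℕ) → G nothing ≡ 0 → ∀ {y} → y < N →
  ∀ {π s} → Describes π s → ∀ e →
  G (push N (push y s)) + insertMaxTotal N (G ∘ push y) s e ≡ insertMaxTotal N G (push y s) (sortedAscentAt y s + e)
insertMaxTotal-push G G∅ y<N (dead _ _)             e = trans (+-identityʳ _) G∅
insertMaxTotal-push G G∅ y<N (viable {c = suc _} v) e = insertMaxTotal-push-just G G∅ y<N (Viable.sorted⇒least≡head v) e
insertMaxTotal-push G G∅ y<N (viable {c = zero}  v) e = contradiction (Viable.runs≥1 v) λ ()

∑ins-max : ∀ {N} (G : Maybe Summary → ℕ) → G nothing ≡ 0 → ∀ {y ys} → All (_< N) (y ∷ ys) →
  ∑ins (G ∘ summarize) N (y ∷ ys) ≡ insertMaxTotal N G (summarize (y ∷ ys)) (sortedAscents (y ∷ ys))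
∑ins-max {N} G G∅ {y} (y<N ∷ []) rewrite ⌊<?⌋-no (<⇒≯ y<N) | ⌊<?⌋-yes y<N =
  regroup (G (just (summary N y false 2 1))) (G (just (summary y y true 1 2)))
  where
  regroup : ∀ X R → X + (R + 0) ≡ X + 0 + R + 0 + 0
  regroup = solve-∀
∑ins-max {N} G G∅ {y} {z ∷ zs} (y<N ∷ zzs<N) = begin
  ∑ins (G ∘ summarize) N (y ∷ z ∷ zs)
    ≡⟨ ∑ins-∷ (G ∘ summarize) N y (z ∷ zs) ⟩
  G (push N (push y s)) + ∑ins (G ∘ summarize ∘ (y ∷_)) N (z ∷ zs)
    ≡⟨ cong (G (push N (push y s)) +_) (∑ins-cong-∷ (λ _ _ → refl) N (z ∷ zs)) ⟩
  G (push N (push y s)) + ∑ins (G ∘ push y ∘ summarize) N (z ∷ zs)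
    ≡⟨ cong (G (push N (push y s)) +_) (∑ins-max (G ∘ push y) G∅ zzs<N) ⟩
  G (push N (push y s)) + insertMaxTotal N (G ∘ push y) s (sortedAscents (z ∷ zs))
    ≡⟨ insertMaxTotal-push G G∅ y<N (summarize-describes z zs) (sortedAscents (z ∷ zs)) ⟩
  insertMaxTotal N G (push y s) (sortedAscentAt y s + sortedAscents (z ∷ zs))
    ≡⟨ cong (insertMaxTotal N G (push y s)) (sortedAscents-∷ y (summarize-describes z zs)) ⟨
  insertMaxTotal N G (summarize (y ∷ z ∷ zs)) (sortedAscents (y ∷ z ∷ zs)) ∎
  where
  s : Maybe Summary
  s = summarize (z ∷ zs)

-- The recurrences for a

counted : ℕ → ℕ → List ℕ → ℕ
counted k r π = 𝟙 (runSorted π ∧ ⌊ runs π ≟ k ⌋ ∧ ⌊ rlMin π ≟ r ⌋)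

a≡∑counted : ∀ n k r → a n k r ≡ ∑ (counted k r) (permsOf n)
a≡∑counted n k r = length-filter (λ π → runSorted π ∧ ⌊ runs π ≟ k ⌋ ∧ ⌊ rlMin π ≟ r ⌋) (permsOf n)

weight : ℕ → ℕ → Maybe Summary → ℕ
weight k r nothing                    = 0
weight k r (just (summary _ _ b c ρ)) = 𝟙 (b ∧ ⌊ c ≟ k ⌋ ∧ ⌊ ρ ≟ r ⌋)

counted≡weight : ∀ k r {π s} → Describes π s → counted k r π ≡ weight k r s
counted≡weight k r {π} (dead unsorted _) = cong (λ g → 𝟙 (g ∧ ⌊ runs π ≟ k ⌋ ∧ ⌊ rlMin π ≟ r ⌋)) unsorted
counted≡weight k r (viable v) = cong 𝟙 (cong₂ _∧_ runSorted≡ (cong₂ _∧_ (cong (λ c → ⌊ c ≟ k ⌋) runs≡) (cong (λ ρ → ⌊ ρ ≟ r ⌋) rlMin≡)))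
  where open Viable v

weight-true : ∀ {b c ρ k r} → T (b ∧ ⌊ c ≟ k ⌋ ∧ ⌊ ρ ≟ r ⌋) → b ≡ true × c ≡ k × ρ ≡ r
weight-true {true} {c} {ρ} {k} {r} t with c ≟ k | ρ ≟ r
... | yes c≡k | yes ρ≡r = refl , c≡k , ρ≡r

insertMaxTotal-weight : ∀ N k r {π s} → Describes π s →
  insertMaxTotal N (weight (suc k) (suc r)) s (sortedAscents π)
    ≡ weight (suc k) r s + k * weight (suc k) (suc r) s + (suc r ∸ k) * weight k (suc r) s
insertMaxTotal-weight N k r (dead _ _) = sym (cong₂ _+_ (*-zeroʳ k) (*-zeroʳ (suc r ∸ k)))
insertMaxTotal-weight N k r {π} (viable {b = b} {c} {ρ} v) =
  cong₂ _+_ (cong₂ _+_ (cong₂ _+_ (*-zeroʳ (𝟙 b)) (cong (λ g → 𝟙 (b ∧ ⌊ c ≟ suc k ⌋ ∧ g)) (⌊≟⌋-suc ρ r))) descents) ascents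
  where
  descents : pred c * 𝟙 (b ∧ ⌊ c ≟ suc k ⌋ ∧ ⌊ ρ ≟ suc r ⌋) ≡ k * 𝟙 (b ∧ ⌊ c ≟ suc k ⌋ ∧ ⌊ ρ ≟ suc r ⌋)
  descents = *-𝟙-cong (pred c) k (b ∧ ⌊ c ≟ suc k ⌋ ∧ ⌊ ρ ≟ suc r ⌋) λ t →
    cong pred (proj₁ (proj₂ (weight-true {b} {c} {ρ} {suc k} {suc r} t)))
  ascents-count : T (b ∧ ⌊ c ≟ k ⌋ ∧ ⌊ ρ ≟ suc r ⌋) → sortedAscents π ≡ suc r ∸ k
  ascents-count t = case weight-true {b} {c} {ρ} {k} {suc r} t of λ where
    (refl , refl , refl) → trans (sym (m+n∸m≡n k _)) (cong (_∸ k) (sym (sorted-balance v)))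
  ascents : sortedAscents π * 𝟙 (b ∧ ⌊ suc c ≟ suc k ⌋ ∧ ⌊ ρ ≟ suc r ⌋) ≡ (suc r ∸ k) * 𝟙 (b ∧ ⌊ c ≟ k ⌋ ∧ ⌊ ρ ≟ suc r ⌋)
  ascents = trans (cong (λ g → sortedAscents π * 𝟙 (b ∧ g ∧ ⌊ ρ ≟ suc r ⌋)) (⌊≟⌋-suc c k))
                  (*-𝟙-cong (sortedAscents π) (suc r ∸ k) (b ∧ ⌊ c ≟ k ⌋ ∧ ⌊ ρ ≟ suc r ⌋) ascents-count)

∑ins-max-counted : ∀ N k r {σ} → NonEmptyBelow N σ →
  ∑ins (counted (suc k) (suc r)) N σ
    ≡ counted (suc k) r σ + k * counted (suc k) (suc r) σ + (suc r ∸ k) * counted k (suc r) σ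
∑ins-max-counted N k r (nonEmpty {y} {ys} σ<N) = begin
  ∑ins (counted (suc k) (suc r)) N (y ∷ ys)
    ≡⟨ ∑ins-cong-∷ (λ u us → counted≡weight (suc k) (suc r) (summarize-describes u us)) N (y ∷ ys) ⟩
  ∑ins (weight (suc k) (suc r) ∘ summarize) N (y ∷ ys)
    ≡⟨ ∑ins-max (weight (suc k) (suc r)) refl σ<N ⟩
  insertMaxTotal N (weight (suc k) (suc r)) s (sortedAscents (y ∷ ys))
    ≡⟨ insertMaxTotal-weight N k r d ⟩
  weight (suc k) r s + k * weight (suc k) (suc r) s + (suc r ∸ k) * weight k (suc r) s
    ≡⟨ cong₂ _+_ (cong₂ _+_ (counted≡weight (suc k) r d) (cong (k *_) (counted≡weight (suc k) (suc r) d)))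
                 (cong ((suc r ∸ k) *_) (counted≡weight k (suc r) d)) ⟨
  counted (suc k) r (y ∷ ys) + k * counted (suc k) (suc r) (y ∷ ys) + (suc r ∸ k) * counted k (suc r) (y ∷ ys) ∎
  where
  s : Maybe Summary
  s = summarize (y ∷ ys)
  d : Describes (y ∷ ys) s
  d = summarize-describes y ys

a-insertMax : ∀ p k r →
  a (2 + p) (suc k) (suc r) ≡ a (1 + p) (suc k) r + k * a (1 + p) (suc k) (suc r) + (suc r ∸ k) * a (1 + p) k (suc r)
a-insertMax p k r = begin
  a (2 + p) (suc k) (suc r)
    ≡⟨ a≡∑counted (2 + p) (suc k) (suc r) ⟩
  ∑ (counted (suc k) (suc r)) (perms (oneTo (2 + p)))
    ≡⟨ cong (∑ (counted (suc k) (suc r)) ∘ perms) (oneTo-∷ʳ p) ⟩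
  ∑ (counted (suc k) (suc r)) (perms (oneTo (1 + p) ++ [ 2 + p ]))
    ≡⟨ ∑-perms-∷ʳ (counted (suc k) (suc r)) (oneTo (1 + p)) (2 + p) ⟩
  ∑ (∑ins (counted (suc k) (suc r)) (2 + p)) Π
    ≡⟨ ∑-congᴬ (All.map (∑ins-max-counted (2 + p) k r) (permsOf-nonEmptyBelow p)) ⟩
  ∑ (λ σ → counted (suc k) r σ + k * counted (suc k) (suc r) σ + (suc r ∸ k) * counted k (suc r) σ) Π
    ≡⟨ ∑-linear (counted (suc k) r) (counted (suc k) (suc r)) (counted k (suc r)) k (suc r ∸ k) Π ⟩
  ∑ (counted (suc k) r) Π + k * ∑ (counted (suc k) (suc r)) Π + (suc r ∸ k) * ∑ (counted k (suc r)) Π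
    ≡⟨ cong₂ _+_ (cong₂ _+_ (a≡∑counted (1 + p) (suc k) r) (cong (k *_) (a≡∑counted (1 + p) (suc k) (suc r))))
                 (cong ((suc r ∸ k) *_) (a≡∑counted (1 + p) k (suc r))) ⟨
  a (1 + p) (suc k) r + k * a (1 + p) (suc k) (suc r) + (suc r ∸ k) * a (1 + p) k (suc r) ∎
  where
  Π : List (List ℕ)
  Π = permsOf (1 + p)

weight-vanishes : ∀ {k r π s} → k ≡ 0 ⊎ r < k → Describes π s → weight k r s ≡ 0
weight-vanishes _ (dead _ _) = refl
weight-vanishes {k} {r} k≡0⊎r<k (viable {b = b} {c} {ρ} v) =
  𝟙-¬T (b ∧ ⌊ c ≟ k ⌋ ∧ ⌊ ρ ≟ r ⌋) λ t → case weight-true {b} {c} {ρ} {k} {r} t , k≡0⊎r<k of λ where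
    ((refl , refl , refl) , inj₁ refl) → contradiction runs≥1 λ ()
    ((refl , refl , refl) , inj₂ r<k)  → <⇒≱ r<k (subst (c ≤_) (sym (sorted-balance v)) (m≤m+n c _))
  where open Viable v

a-vanishes : ∀ p k r → k ≡ 0 ⊎ r < k → a (1 + p) k r ≡ 0
a-vanishes p k r k≡0⊎r<k = trans (a≡∑counted (1 + p) k r) (∑-zero (All.map vanishes (permsOf-nonEmptyBelow p)))
  where
  vanishes : ∀ {σ} → NonEmptyBelow (2 + p) σ → counted k r σ ≡ 0
  vanishes (nonEmpty {y} {ys} _) =
    trans (counted≡weight k r (summarize-describes y ys)) (weight-vanishes k≡0⊎r<k (summarize-describes y ys))

WeightedRecurrence : ℕ → Set
WeightedRecurrence n = ∀ k r → (suc r ∸ k) * a (suc n) k (suc r) ≡ n * a n k r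

a-weighted-step-≤ : ∀ q k r → k ≤ r → WeightedRecurrence (suc q) →
  (suc r ∸ k) * a (3 + q) (suc k) (2 + r) ≡ (2 + q) * a (2 + q) (suc k) (suc r)
a-weighted-step-≤ q k r k≤r IH = begin
  (suc r ∸ k) * a (3 + q) (suc k) (2 + r)
    ≡⟨ cong₂ _*_ d+1 (a-insertMax (suc q) k (suc r)) ⟩
  suc d * (U + k * V + e * W)
    ≡⟨ distribute U V W d k e ⟩
  U + d * U + k * (suc d * V) + suc d * (e * W)
    ≡⟨ cong₂ (λ x y → U + x + k * y + suc d * (e * W)) (IH (suc k) r)
                                                      (trans (cong (_* V) (sym d+1)) (IH (suc k) (suc r))) ⟩
  U + suc q * X₁ + k * (suc q * X₂) + suc d * (e * W)
    ≡⟨ cong (λ x → U + suc q * X₁ + k * (suc q * X₂) + suc d * x) (IH k (suc r)) ⟩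
  U + suc q * X₁ + k * (suc q * X₂) + suc d * (suc q * X₃)
    ≡⟨ collect U X₁ X₂ X₃ q k d ⟩
  U + suc q * (X₁ + k * X₂ + suc d * X₃)
    ≡⟨ cong (λ x → U + suc q * (X₁ + k * X₂ + x * X₃)) d+1 ⟨
  U + suc q * (X₁ + k * X₂ + (suc r ∸ k) * X₃)
    ≡⟨ cong (λ x → U + suc q * x) (a-insertMax q k r) ⟨
  U + suc q * U ∎
  where
  d e U V W X₁ X₂ X₃ : ℕ
  d = r ∸ k
  e = 2 + r ∸ k
  U = a (2 + q) (suc k) (suc r)
  V = a (2 + q) (suc k) (2 + r)
  W = a (2 + q) k (2 + r)
  X₁ = a (1 + q) (suc k) r
  X₂ = a (1 + q) (suc k) (suc r)
  X₃ = a (1 + q) k (suc r)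
  d+1 : suc r ∸ k ≡ suc d
  d+1 = +-∸-assoc 1 k≤r
  distribute : ∀ U V W d k e → suc d * (U + k * V + e * W) ≡ U + d * U + k * (suc d * V) + suc d * (e * W)
  distribute = solve-∀
  collect : ∀ U X₁ X₂ X₃ q k d →
            U + suc q * X₁ + k * (suc q * X₂) + suc d * (suc q * X₃) ≡ U + suc q * (X₁ + k * X₂ + suc d * X₃)
  collect = solve-∀

a-weighted-step : ∀ q → WeightedRecurrence (suc q) → WeightedRecurrence (2 + q)
a-weighted-step q IH zero r =
  ≡-via-zero (2 + q) (trans (cong (suc r *_) (a-vanishes (2 + q) 0 (suc r) (inj₁ refl))) (*-zeroʳ (suc r)))
             (a-vanishes (1 + q) 0 r (inj₁ refl))
a-weighted-step q IH (suc k) zero =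
  ≡-via-zero (2 + q) (cong (_* a (3 + q) (suc k) 1) (0∸n≡0 k)) (a-vanishes (1 + q) (suc k) 0 (inj₂ (s≤s z≤n)))
a-weighted-step q IH (suc k) (suc r) with k ≤? r
... | yes k≤r = a-weighted-step-≤ q k r k≤r IH
... | no  k≰r = ≡-via-zero (2 + q) (cong (_* a (3 + q) (suc k) (2 + r)) (m≤n⇒m∸n≡0 (≰⇒> k≰r)))
                           (a-vanishes (1 + q) (suc k) (suc r) (inj₂ (s≤s (≰⇒> k≰r))))

a-weighted : ∀ n → WeightedRecurrence n
a-weighted zero zero                r             = *-zeroʳ (suc r)
a-weighted zero (suc zero)          zero          = refl
a-weighted zero (suc zero)          (suc r)       = *-zeroʳ (suc r)
a-weighted zero (suc (suc k))       r             = *-zeroʳ (suc r ∸ suc (suc k))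
a-weighted (suc zero) zero          r             = *-zeroʳ (suc r)
a-weighted (suc zero) (suc zero)    zero          = refl
a-weighted (suc zero) (suc zero)    (suc zero)    = refl
a-weighted (suc zero) (suc zero)    (suc (suc r)) = *-zeroʳ (suc (suc r))
a-weighted (suc zero) (suc (suc k)) r             = *-zeroʳ (suc r ∸ suc (suc k))
a-weighted (suc (suc q)) = a-weighted-step q (a-weighted (suc q))

theorem29 : (n k r : ℕ) → 2 ≤ n → 1 ≤ k → 1 ≤ r →
    a n k r ≡ a (n ∸ 1) k (r ∸ 1) + (k ∸ 1) * a (n ∸ 1) k r + (n ∸ 2) * a (n ∸ 2) (k ∸ 1) (r ∸ 1)
theorem29 (suc (suc p)) (suc k) (suc r) _ _ _ = begin
  a (2 + p) (suc k) (suc r)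
    ≡⟨ a-insertMax p k r ⟩
  a (1 + p) (suc k) r + k * a (1 + p) (suc k) (suc r) + (suc r ∸ k) * a (1 + p) k (suc r)
    ≡⟨ cong (a (1 + p) (suc k) r + k * a (1 + p) (suc k) (suc r) +_) (a-weighted p k r) ⟩
  a (1 + p) (suc k) r + k * a (1 + p) (suc k) (suc r) + p * a p k r ∎
theorem29 0             _       _       ()
theorem29 1             _       _       (s≤s ())
theorem29 (suc (suc p)) 0       _       _ ()
theorem29 (suc (suc p)) (suc k) 0       _ _ ()
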